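{- Let $G$ be a finite group with an essential cyclic set $Max_G$ satisfying $|Max_G|\geq 3$. If $G$ has an awning, then $icn(G)\leq 1$. In particular, $|InMax_G|\leq 1$.
   Context: Let $G$ be a finite group with identity $e$. An essential cyclic set $Max_G=\{x_1,\dots,x_m\}$ is a set of elements of $G$ such that $\langle x_1\rangle,\dots,\langle x_m\rangle$ are pairwise distinct and are exactly the maximal cyclic subgroups of $G$. The independence cyclic set is $ics(G)=\{x_i\in Max_G:\langle x_i\rangle\cap\langle x_j\rangle=\{e\}\text{ for all }j\neq i\}$ and $icn(G)=|ics(G)|$. $InMax_G$ denotes the set of maximal involutions of $G$, i.e. involutions $t\in G$ such that $\langle t\rangle$ is a maximal cyclic subgroup of $G$. Awning: given an ordering $x_1,\dots,x_m$ of $Max_G$, an awning is a family of indexed sets $H_1,\dots,H_{m-1}$, where $H_i=\{h_{i,i+1},\dots,h_{i,m}\}\subseteq\langle x_i\rangle$ is partitioned as $H_i=A_i\,\dot\cup\,B_i$, such that (1) $h_{i,j}\in\langle x_i\rangle\cap\langle x_j\rangle$ for all $i<j$; (2) whenever $i<j$, $2\le j\le m-1$, $s\in\{j+1,\dots,m\}$, $r\in\{i+1,\dots,m\}$ and $h_{j,s}=h_{i,r}$: (a) if $r=j$ and $h_{i,r}\in A_i$ then $h_{j,s}\in B_j$; (b) if $r=j$ and $h_{i,r}\in B_i$ then $h_{j,s}\in A_j$; (c) if $r=s>j$ and $h_{i,r}\in A_i$ then $h_{j,r}\in A_j$; (d) if $r=s>j$ and $h_{i,r}\in B_i$ then $h_{j,r}\in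 B_j$. $G$ has an awning if an awning exists for some ordering of $Max_G$. -}

module Defs where

open import Level using (Level)
open import Data.Nat using (ℕ; zero; suc)
open import Data.Integer using (ℤ; +_; -[1+_])
open import Data.Fin using (Fin; _<_)
open import Data.Fin.Permutation using (Permutation′; _⟨$⟩ʳ_)
open import Data.Product using (Σ; ∃; _×_; _,_)
open import Data.Sum using (_⊎_)
open import Relation.Nullary using (¬_)
open import Relation.Binary.PropositionalEquality using (_≡_; _≢_)
open import Algebra.Structures using (IsGroup)
open import Function using (_∘_)
import Data.Empty

record FiniteGroup (c : Level) : Set (Level.suc c) where
  field
    Carrier : Set c
    _∙_     : Carrier → Carrier → Carrier
    ε       : Carrier
    _⁻¹     : Carrier → Carrier
    isGroup : IsGroup _≡_ _∙_ ε _⁻¹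
    size    : ℕ
    enum    : Fin size → Carrier
    enum-surjective : ∀ x → ∃ λ i → enum i ≡ x

module _ {c : Level} (G : FiniteGroup c) where
  open FiniteGroup G

  powℕ : Carrier → ℕ → Carrier
  powℕ x zero    = ε
  powℕ x (suc k) = x ∙ powℕ x k

  pow : Carrier → ℤ → Carrier
  pow x (+ k)      = powℕ x k
  pow x -[1+ k ]   = (powℕ x (suc k)) ⁻¹

  _∈⟨_⟩ : Carrier → Carrier → Set c
  z ∈⟨ x ⟩ = ∃ λ (k : ℤ) → pow x k ≡ z

  _⊆⟨⟩_ : Carrier → Carrier → Set c
  x ⊆⟨⟩ y = ∀ z → z ∈⟨ x ⟩ → z ∈⟨ y ⟩

  _≐⟨⟩_ : Carrier → Carrier → Set c
  x ≐⟨⟩ y = (x ⊆⟨⟩ y) × (y ⊆⟨⟩ x)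

  MaxCyclic : Carrier → Set c
  MaxCyclic x = ∀ y → x ⊆⟨⟩ y → y ⊆⟨⟩ x

  IsEssentialCyclicSet : (m : ℕ) → (Fin m → Carrier) → Set c
  IsEssentialCyclicSet m x =
    (∀ i → MaxCyclic (x i)) ×
    (∀ i j → i ≢ j → ¬ (x i ≐⟨⟩ x j)) ×
    (∀ y → MaxCyclic y → ∃ λ i → y ≐⟨⟩ x i)

  InICS : {m : ℕ} → (Fin m → Carrier) → Fin m → Set c
  InICS x i = ∀ j → j ≢ i → ∀ z → z ∈⟨ x i ⟩ → z ∈⟨ x j ⟩ → z ≡ ε

  InMax : Carrier → Set c
  InMax t = (t ∙ t ≡ ε) × (t ≢ ε) × MaxCyclic t

  -- An awning for the ordered list x_1,…,x_m (0-indexed as Fin m).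
  -- h i r stands for h_{i,r} (only used for i < r);
  -- A i, B i are the parts of the partition H_i = A_i ∪̇ B_i.
  record Awning {m : ℕ} (x : Fin m → Carrier) : Set (Level.suc c) where
    field
      h : Fin m → Fin m → Carrier
      A : Fin m → Carrier → Set c
      B : Fin m → Carrier → Set c
      -- H_i = A_i ∪̇ B_i, where H_i = {h_{i,r} : r > i}
      A⊆H : ∀ i z → A i z → ∃ λ r → (i < r) × (h i r ≡ z)
      B⊆H : ∀ i z → B i z → ∃ λ r → (i < r) × (h i r ≡ z)
      H⊆A∪B : ∀ i r → i < r → A i (h i r) ⊎ B i (h i r)
      A∩B : ∀ i z → A i z → B i z → Data.Empty.⊥
      h∈ : ∀ i j → i < j → (h i j ∈⟨ x i ⟩) × (h i j ∈⟨ x j ⟩)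
      cond-a : ∀ i j s r → i < j → j < s → i < r → h j s ≡ h i r →
               r ≡ j → A i (h i r) → B j (h j s)
      cond-b : ∀ i j s r → i < j → j < s → i < r → h j s ≡ h i r →
               r ≡ j → B i (h i r) → A j (h j s)
      cond-c : ∀ i j s r → i < j → j < s → i < r → h j s ≡ h i r →
               r ≡ s → A i (h i r) → A j (h j r)
      cond-d : ∀ i j s r → i < j → j < s → i < r → h j s ≡ h i r →
               r ≡ s → B i (h i r) → B j (h j r)

  HasAwning : {m : ℕ} → (Fin m → Carrier) → Set (Level.suc c)
  HasAwning {m} x = ∃ λ (σ : Permutation′ m) → Awning (x ∘ (σ ⟨$⟩ʳ_))

-- The combinatorial heart is a property of awnings alone: the three values
-- h_{i,j}, h_{i,s}, h_{j,s} (i < j < s) are never all equal, because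
-- rules (a)–(d) would put h_{j,s} into both A_j and B_j.  If x_p and x_q
-- (p ≠ q) were both independent, then, since m ≥ 3, some third index k
-- exists, and every h-value on an edge touching p or q lies in a trivial
-- intersection, hence is e; so the triangle {k, p, q} has all three
-- h-values equal to e, which is impossible.  An awning is given for a
-- reordering x ∘ σ of Max_G, and independence is invariant under injective
-- reindexing, so the bound transfers back to x.
--
-- For the second claim, ⟨t⟩ = {e, t} for an involution t; a maximal
-- involution therefore generates some ⟨x_i⟩ with i independent, and two
-- maximal involutions sharing that index generate the same subgroup {e, t}.

module Submission where

open import Defs
open import Level using (Level)
open import Data.Nat using (ℕ; _≤_; s≤s; _+_)
  renaming (zero to 0ℕ; suc to 1+_)
open import Data.Fin using (Fin; zero; suc; _<_)
open import Data.Fin.Properties using (<-cmp; <-trans; <⇒≢; _≟_)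
open import Data.Fin.Permutation using (_⟨$⟩ʳ_; _⟨$⟩ˡ_; inverseʳ)
open import Data.Product using (_×_; _,_; ∃; proj₁; proj₂)
open import Data.Sum using (_⊎_; inj₁; inj₂)
open import Data.Empty using (⊥; ⊥-elim)
open import Data.Integer using (+_; -[1+_])
open import Relation.Nullary using (yes; no)
open import Relation.Binary using (tri<; tri≈; tri>)
open import Relation.Binary.PropositionalEquality
open import Algebra.Bundles using (Group)
open import Function using (_∘_)
open import Function.Bundles using (Injection)
open import Function.Definitions using (Injective)
open import Function.Properties.Inverse using (↔⇒↣)
import Algebra.Properties.Group as GroupProperties

avoidOneOf : ∀ {n} (a b : Fin n) → a ≢ b → (q : Fin n) → (a ≢ q) ⊎ (b ≢ q)
avoidOneOf a b a≢b q with a ≟ q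
... | yes refl = inj₂ (λ b≡a → a≢b (sym b≡a))
... | no a≢q   = inj₁ a≢q

thirdIndex : ∀ {n} (p q : Fin (3 + n)) → ∃ λ k → (k ≢ p) × (k ≢ q)
thirdIndex p q with zero ≟ p
... | yes refl with avoidOneOf (suc zero) (suc (suc zero)) (λ ()) q
...   | inj₁ 1≢q = suc zero , (λ ()) , 1≢q
...   | inj₂ 2≢q = suc (suc zero) , (λ ()) , 2≢q
thirdIndex p q | no 0≢p with zero ≟ q
... | no 0≢q = zero , 0≢p , 0≢q
... | yes refl with avoidOneOf (suc zero) (suc (suc zero)) (λ ()) p
...   | inj₁ 1≢p = suc zero , 1≢p , (λ ())
...   | inj₂ 2≢p = suc (suc zero) , 2≢p , (λ ())

module _ {c : Level} (G : FiniteGroup c) where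
  open FiniteGroup G

  module _ {m : ℕ} {y : Fin m → Carrier} (aw : Awning G y) where
    open Awning aw

    -- The awning rules forbid a triangle i < j < s whose three h-values
    -- coincide: h_{j,s} would land in both A_j and B_j.
    noEqualTriangle : ∀ {i j s} → i < j → j < s →
      h i j ≡ h i s → h j s ≡ h i j → ⊥
    noEqualTriangle {i} {j} {s} i<j j<s hij≡his hjs≡hij with H⊆A∪B i j i<j
    ... | inj₁ inA = A∩B j (h j s)
      (cond-c i j s s i<j j<s i<s hjs≡his refl (subst (A i) hij≡his inA))
      (cond-a i j s j i<j j<s i<j hjs≡hij refl inA)
      where
      i<s = <-trans i<j j<s
      hjs≡his = trans hjs≡hij hij≡his
    ... | inj₂ inB = A∩B j (h j s)
      (cond-b i j s j i<j j<s i<j hjs≡hij refl inB)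
      (cond-d i j s s i<j j<s i<s hjs≡his refl (subst (B i) hij≡his inB))
      where
      i<s = <-trans i<j j<s
      hjs≡his = trans hjs≡hij hij≡his

    noTrivialTriangle : ∀ {i j s} → i < j → j < s →
      h i j ≡ ε → h i s ≡ ε → h j s ≡ ε → ⊥
    noTrivialTriangle i<j j<s hij≡ε his≡ε hjs≡ε =
      noEqualTriangle i<j j<s (trans hij≡ε (sym his≡ε)) (trans hjs≡ε (sym hij≡ε))

    -- h_{i,j} lies in ⟨x_i⟩ ∩ ⟨x_j⟩, which is trivial if i or j is independent.
    independentEdge : ∀ {i j} → i < j → InICS G y i ⊎ InICS G y j → h i j ≡ ε
    independentEdge {i} {j} i<j (inj₁ ics-i) =
      ics-i j (λ j≡i → <⇒≢ i<j (sym j≡i)) (h i j) (proj₁ (h∈ i j i<j)) (proj₂ (h∈ i j i<j))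
    independentEdge {i} {j} i<j (inj₂ ics-j) =
      ics-j i (<⇒≢ i<j) (h i j) (proj₂ (h∈ i j i<j)) (proj₁ (h∈ i j i<j))

    -- Two independent indices p < q and any third index k span a triangle
    -- all of whose edges touch p or q, hence are trivial.
    noTwoIndependent : ∀ {p q} k → k ≢ p → k ≢ q → p < q →
      InICS G y p → InICS G y q → ⊥
    noTwoIndependent {p} {q} k k≢p k≢q p<q ics-p ics-q with <-cmp k p | <-cmp k q
    ... | tri≈ _ k≡p _ | _ = k≢p k≡p
    ... | _ | tri≈ _ k≡q _ = k≢q k≡q
    ... | tri< k<p _ _ | _ = noTrivialTriangle k<p p<q
      (independentEdge k<p (inj₂ ics-p))
      (independentEdge (<-trans k<p p<q) (inj₂ ics-q))
      (independentEdge p<q (inj₁ ics-p))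
    ... | tri> _ _ p<k | tri< k<q _ _ = noTrivialTriangle p<k k<q
      (independentEdge p<k (inj₁ ics-p))
      (independentEdge p<q (inj₁ ics-p))
      (independentEdge k<q (inj₂ ics-q))
    ... | tri> _ _ _ | tri> _ _ q<k = noTrivialTriangle p<q q<k
      (independentEdge p<q (inj₁ ics-p))
      (independentEdge (<-trans p<q q<k) (inj₁ ics-p))
      (independentEdge q<k (inj₁ ics-q))

  awningIndependentUnique : ∀ {m} {y : Fin m → Carrier} → 3 ≤ m → Awning G y →
    ∀ p q → InICS G y p → InICS G y q → p ≡ q
  awningIndependentUnique (s≤s (s≤s (s≤s _))) aw p q ics-p ics-q with <-cmp p q
  ... | tri≈ _ p≡q _ = p≡q
  ... | tri< p<q _ _ with thirdIndex p q
  ...   | k , k≢p , k≢q = ⊥-elim (noTwoIndependent aw k k≢p k≢q p<q ics-p ics-q)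
  awningIndependentUnique (s≤s (s≤s (s≤s _))) aw p q ics-p ics-q | tri> _ _ q<p
    with thirdIndex q p
  ...   | k , k≢q , k≢p = ⊥-elim (noTwoIndependent aw k k≢q k≢p q<p ics-q ics-p)

  reindexInICS : ∀ {m n} (x : Fin m → Carrier) (f : Fin n → Fin m) →
    Injective _≡_ _≡_ f → ∀ p → InICS G x (f p) → InICS G (x ∘ f) p
  reindexInICS x f f-injective p ics j j≢p = ics (f j) (j≢p ∘ f-injective)

  icnAtMostOne : ∀ {m} (x : Fin m → Carrier) → 3 ≤ m → HasAwning G x →
    ∀ i j → InICS G x i → InICS G x j → i ≡ j
  icnAtMostOne x 3≤m (σ , aw) i j ics-i ics-j = begin
    i                   ≡⟨ sym (inverseʳ σ) ⟩
    σ ⟨$⟩ʳ (σ ⟨$⟩ˡ i)   ≡⟨ cong (σ ⟨$⟩ʳ_) σ⁻¹i≡σ⁻¹j ⟩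
    σ ⟨$⟩ʳ (σ ⟨$⟩ˡ j)   ≡⟨ inverseʳ σ ⟩
    j                   ∎
    where
    open ≡-Reasoning
    pull : ∀ k → InICS G x k → InICS G (x ∘ (σ ⟨$⟩ʳ_)) (σ ⟨$⟩ˡ k)
    pull k ics-k = reindexInICS x (σ ⟨$⟩ʳ_) (Injection.injective (↔⇒↣ σ)) (σ ⟨$⟩ˡ k)
      (subst (InICS G x) (sym (inverseʳ σ)) ics-k)
    σ⁻¹i≡σ⁻¹j = awningIndependentUnique 3≤m aw _ _ (pull i ics-i) (pull j ics-j)

  group : Group c c
  group = record { isGroup = isGroup }

  open GroupProperties group using (inverseˡ-unique; ε⁻¹≈ε)
  open Group group using (identityʳ)

  module _ {t : Carrier} (t∙t≡ε : t ∙ t ≡ ε) where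

    involutionPowℕ : ∀ k → (powℕ G t k ≡ ε) ⊎ (powℕ G t k ≡ t)
    involutionPowℕ 0ℕ = inj₁ refl
    involutionPowℕ (1+ k) with involutionPowℕ k
    ... | inj₁ tᵏ≡ε = inj₂ (trans (cong (t ∙_) tᵏ≡ε) (identityʳ t))
    ... | inj₂ tᵏ≡t = inj₁ (trans (cong (t ∙_) tᵏ≡t) t∙t≡ε)

    involutionSubgroup : ∀ {z} → _∈⟨_⟩ G z t → (z ≡ ε) ⊎ (z ≡ t)
    involutionSubgroup (+ k , tᵏ≡z) with involutionPowℕ k
    ... | inj₁ tᵏ≡ε = inj₁ (trans (sym tᵏ≡z) tᵏ≡ε)
    ... | inj₂ tᵏ≡t = inj₂ (trans (sym tᵏ≡z) tᵏ≡t)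
    involutionSubgroup (-[1+ k ] , t⁻ᵏ≡z) with involutionPowℕ (1+ k)
    ... | inj₁ tᵏ≡ε = inj₁ (trans (sym t⁻ᵏ≡z) (trans (cong _⁻¹ tᵏ≡ε) ε⁻¹≈ε))
    ... | inj₂ tᵏ≡t = inj₂ (trans (sym t⁻ᵏ≡z) (trans (cong _⁻¹ tᵏ≡t) t⁻¹≡t))
      where
      t⁻¹≡t : t ⁻¹ ≡ t
      t⁻¹≡t = sym (inverseˡ-unique t t t∙t≡ε)

    involutionSubset : ∀ {w} → _∈⟨_⟩ G t w → _⊆⟨⟩_ G t w
    involutionSubset t∈⟨w⟩ z z∈⟨t⟩ with involutionSubgroup z∈⟨t⟩
    ... | inj₁ refl = + 0 , refl
    ... | inj₂ refl = t∈⟨w⟩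

  -- A maximal involution generates ⟨x_i⟩ for an independent index i: a
  -- non-trivial element of ⟨x_i⟩ ∩ ⟨x_j⟩ would be t, forcing ⟨x_i⟩ ⊆ ⟨x_j⟩
  -- and, by maximality, ⟨x_i⟩ = ⟨x_j⟩.
  maxInvolutionIndependent : ∀ {m} (x : Fin m → Carrier) → IsEssentialCyclicSet G m x →
    ∀ {t} → InMax G t → ∃ λ i → (_≐⟨⟩_ G t (x i)) × InICS G x i
  maxInvolutionIndependent x (maximal , distinct , covering) {t} (t∙t≡ε , _ , t-max)
    with covering t t-max
  ... | i , t≐xᵢ@(_ , xᵢ⊆t) = i , t≐xᵢ , independent
    where
    independent : InICS G x i
    independent j j≢i z z∈⟨xᵢ⟩ z∈⟨xⱼ⟩ with involutionSubgroup t∙t≡ε (xᵢ⊆t z z∈⟨xᵢ⟩)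
    ... | inj₁ z≡ε = z≡ε
    ... | inj₂ refl = ⊥-elim (distinct i j (λ i≡j → j≢i (sym i≡j)) (xᵢ⊆xⱼ , maximal i (x j) xᵢ⊆xⱼ))
      where
      xᵢ⊆xⱼ : _⊆⟨⟩_ G (x i) (x j)
      xᵢ⊆xⱼ w w∈⟨xᵢ⟩ = involutionSubset t∙t≡ε z∈⟨xⱼ⟩ w (xᵢ⊆t w w∈⟨xᵢ⟩)

  -- If icn(G) ≤ 1 then |InMax_G| ≤ 1: two maximal involutions t, u share
  -- their independent index, so u ∈ ⟨t⟩ = {e, t} and u ≠ e.
  maxInvolutionUnique : ∀ {m} (x : Fin m → Carrier) → IsEssentialCyclicSet G m x →
    (∀ i j → InICS G x i → InICS G x j → i ≡ j) →
    ∀ t u → InMax G t → InMax G u → t ≡ u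
  maxInvolutionUnique x ess icn≤1 t u t-inv@(t∙t≡ε , _ , _) u-inv@(_ , u≢ε , _)
    with maxInvolutionIndependent x ess t-inv | maxInvolutionIndependent x ess u-inv
  ... | i , (_ , xᵢ⊆t) , ics-i | j , (u⊆xⱼ , _) , ics-j
    with icn≤1 i j ics-i ics-j
  ... | refl with involutionSubgroup t∙t≡ε (xᵢ⊆t u (u⊆xⱼ u (+ 1 , identityʳ u)))
  ...   | inj₁ u≡ε = ⊥-elim (u≢ε u≡ε)
  ...   | inj₂ u≡t = sym u≡t

corollary2p10 : {c : Level} (G : FiniteGroup c) (m : ℕ) (x : Fin m → FiniteGroup.Carrier G) →
    IsEssentialCyclicSet G m x → 3 ≤ m → HasAwning G x →
    (∀ i j → InICS G x i → InICS G x j → i ≡ j) ×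
    (∀ t u → InMax G t → InMax G u → t ≡ u)
corollary2p10 G m x ess 3≤m awning = icn≤1 , maxInvolutionUnique G x ess icn≤1
  where
  icn≤1 = icnAtMostOne G x 3≤m awning
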